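{- Let $B$ be an $r$-graph whose underlying simple graph is the Petersen graph $P$, and for each edge $e$ of $P$ let $c(e)\in\mathbb{Z}_{>0}$ be the number of parallel edges of $B$ corresponding to $e$. Let $M_1,\dots,M_6$ be the six perfect matchings of $P$, viewed as $0/1$ vectors in $\mathbb{R}^{E(P)}$, and write $c=\sum_{i=1}^6\alpha_iM_i$ with $\alpha_i\in\mathbb{R}$. Then $\alpha_i\ge 0$ for all $i$, and either $\alpha_i\in\mathbb{Z}$ for all $i$, or $\alpha_i\in \tfrac12+\mathbb{Z}$ for all $i$.
   Context: Graphs are finite, loopless, and may have parallel edges. An $r$-graph is an $r$-regular graph in which every odd cut (set of edges between $S$ and $V\setminus S$ with $|S|$ and $|V\setminus S|$ both odd) has at least $r$ edges. Since $B$ is $r$-regular, the weight vector $c$ has the same weighted degree $r$ at every vertex of $P$; the space of vectors in $\mathbb{R}^{E(P)}$ with equal weighted degree at all vertices is $6$-dimensional and has $M_1,\dots,M_6$ as a basis, so the coefficients $\alpha_i$ exist and are unique.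
   Formalization: The coefficients $\alpha_i$ are taken over the rationals rather than the reals. -}

module Defs where

open import Data.Nat using (ℕ; zero; suc; _%_)
import Data.Nat as ℕ
open import Data.Bool using (Bool; true; false; _xor_; _∨_; if_then_else_)
open import Data.Fin using (Fin; zero; suc; #_; _≟_)
open import Data.Product using (_×_; _,_; proj₁; proj₂)
open import Data.Vec using (Vec; _∷_; []; lookup)
open import Data.Rational using (ℚ)
import Data.Rational as ℚ
open import Relation.Nullary.Decidable using (does)
open import Relation.Binary.PropositionalEquality using (_≡_)

Σℕ : ∀ n → (Fin n → ℕ) → ℕ
Σℕ zero    f = 0
Σℕ (suc n) f = f zero ℕ.+ Σℕ n (λ i → f (suc i))

Σℚ : ∀ n → (Fin n → ℚ) → ℚ
Σℚ zero    f = ℚ.0ℚ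
Σℚ (suc n) f = f zero ℚ.+ Σℚ n (λ i → f (suc i))

[_] : Bool → ℕ
[ b ] = if b then 1 else 0

[_]ℚ : Bool → ℚ
[ b ]ℚ = if b then ℚ.1ℚ else ℚ.0ℚ

Odd : ℕ → Set
Odd n = n % 2 ≡ 1

-- The Petersen graph P.
-- Vertices 0..4: outer 5-cycle; 5..9: inner pentagram (i ~ i+2 mod 5);
-- spokes i – i+5.

V : Set
V = Fin 10

E : Set
E = Fin 15

edgeTable : Vec (V × V) 15
edgeTable =
  (# 0 , # 1) ∷
  (# 1 , # 2) ∷
  (# 2 , # 3) ∷
  (# 3 , # 4) ∷
  (# 4 , # 0) ∷
  (# 0 , # 5) ∷
  (# 1 , # 6) ∷
  (# 2 , # 7) ∷
  (# 3 , # 8) ∷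
  (# 4 , # 9) ∷
  (# 5 , # 7) ∷
  (# 6 , # 8) ∷
  (# 7 , # 9) ∷
  (# 8 , # 5) ∷
  (# 9 , # 6) ∷ []

end₁ end₂ : E → V
end₁ e = proj₁ (lookup edgeTable e)
end₂ e = proj₂ (lookup edgeTable e)

incident : V → E → Bool
incident x e = does (x ≟ end₁ e) ∨ does (x ≟ end₂ e)

IsPerfectMatching : (E → Bool) → Set
IsPerfectMatching M = ∀ x → Σℕ 15 (λ e → [ M e ] ℕ.* [ incident x e ]) ≡ 1

-- A multigraph B whose underlying simple graph is P is determined (up to
-- isomorphism) by the multiplicities c : E → ℕ with c e ≥ 1 for each
-- edge e of P (c e parallel copies of e).

degree : (E → ℕ) → V → ℕ
degree c x = Σℕ 15 (λ e → c e ℕ.* [ incident x e ])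

size : (V → Bool) → ℕ
size S = Σℕ 10 (λ x → [ S x ])

cutSize : (E → ℕ) → (V → Bool) → ℕ
cutSize c S = Σℕ 15 (λ e → c e ℕ.* [ S (end₁ e) xor S (end₂ e) ])

IsRGraph : ℕ → (E → ℕ) → Set
IsRGraph r c =
  (∀ x → degree c x ≡ r) ×
  (∀ (S : V → Bool) → Odd (size S) → Odd (10 ℕ.∸ size S) → r ℕ.≤ cutSize c S)

-- P has exactly six perfect matchings. For each of them, M_k, there is a 5-vertex set S_k whose cut
-- contains all five edges of M_k and exactly one edge of every other perfect matching, so in B
-- the cut of S_k has size Σα + 4α_k, while every vertex has degree r = Σα; the odd-cut condition
-- therefore gives α_k ≥ 0. Any two perfect matchings M_i, M_j share an edge lying in no third one,
-- whence α_i + α_j = c(e) ∈ ℤ; so 2α_i ∈ ℤ and all α_i lie in the same class of ℚ modulo ℤ.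
module Submission where

open import Defs
open import Data.Nat using (ℕ; zero; suc; s≤s)
import Data.Nat as ℕ
import Data.Nat.Properties as ℕP
open import Data.Nat.Divisibility using (∣1⇒≡1)
open import Data.Fin using (Fin; zero; suc; #_; _≟_)
open import Data.Fin.Properties using (all?; any?)
open import Data.Bool using (Bool; true; false; _∧_; _xor_)
import Data.Integer as ℤ
open import Data.Integer using (ℤ)
import Data.Integer.Properties as ℤP
open import Data.Integer.DivMod using (_%ℕ_; _/ℕ_; a≡a%ℕn+[a/ℕn]*n; n%ℕd<d)
open import Data.Rational using (ℚ; mkℚ; *≤*; _≤_; _+_; _*_; _-_; -_; 0ℚ; 1ℚ; ½; _/_)
import Data.Rational.Properties as ℚP
open import Data.Rational.Solver using (module +-*-Solver)
open import Algebra.Bundles using (CommutativeRing)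
open import Algebra.Properties.Semiring.Sum (CommutativeRing.semiring ℚP.+-*-commutativeRing)
  using (sum; sum-syntax; sum-cong-≗; sum-replicate-zero; ∑-distrib-+; ∑-comm; *-distribˡ-sum; *-distribʳ-sum)
open import Data.List using (List; _∷_; [])
import Data.List.Relation.Unary.Any as List
open import Data.Vec using (_∷_; []; lookup; tabulate)
open import Data.Vec.Properties using (lookup∘tabulate)
open import Data.Product using (∃; _×_; _,_; proj₁; proj₂)
open import Data.Sum using (_⊎_; inj₁; inj₂)
import Data.Sum as Sum
open import Data.Empty using (⊥-elim)
open import Function using (_∘_)
open import Relation.Nullary using (yes; no; does; ¬?)
open import Relation.Nullary.Decidable using (from-yes; _→-dec_; _×-dec_)
open import Relation.Binary.PropositionalEquality
  using (_≡_; _≢_; refl; sym; trans; cong; cong₂; subst₂; module ≡-Reasoning)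
open +-*-Solver

fromℤ : ℤ → ℚ
fromℤ z = z / 1

fromℕ : ℕ → ℚ
fromℕ n = fromℤ (ℤ.+ n)

-- For a variable z, `z / 1` is stuck in its gcd normalisation; rewriting with this equation exposes
-- the representation on which _+_, _*_ and _≤_ compute.
fromℤ≡mkℚ : ∀ z → fromℤ z ≡ mkℚ z 0 (λ { (_ , d∣1) → ∣1⇒≡1 d∣1 })
fromℤ≡mkℚ z = ℚP.↥p/↧p≡p (mkℚ z 0 _)

fromℤ-homo-+ : ∀ a b → fromℤ (a ℤ.+ b) ≡ fromℤ a + fromℤ b
fromℤ-homo-+ a b rewrite fromℤ≡mkℚ a | fromℤ≡mkℚ b =
  cong fromℤ (sym (cong₂ ℤ._+_ (ℤP.*-identityʳ a) (ℤP.*-identityʳ b)))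

fromℤ-homo-* : ∀ a b → fromℤ (a ℤ.* b) ≡ fromℤ a * fromℤ b
fromℤ-homo-* a b rewrite fromℤ≡mkℚ a | fromℤ≡mkℚ b = refl

fromℤ-homo‿- : ∀ a → fromℤ (ℤ.- a) ≡ - fromℤ a
fromℤ-homo‿- a rewrite fromℤ≡mkℚ a | fromℤ≡mkℚ (ℤ.- a) with a
... | ℤ.+ 0      = refl
... | ℤ.+[1+ n ] = refl
... | ℤ.-[1+ n ] = refl

fromℤ-homo-- : ∀ a b → fromℤ (a ℤ.- b) ≡ fromℤ a - fromℤ b
fromℤ-homo-- a b = trans (fromℤ-homo-+ a (ℤ.- b)) (cong (fromℤ a +_) (fromℤ-homo‿- b))

fromℕ-homo-+ : ∀ m n → fromℕ (m ℕ.+ n) ≡ fromℕ m + fromℕ n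
fromℕ-homo-+ m n = fromℤ-homo-+ (ℤ.+ m) (ℤ.+ n)

fromℕ-homo-* : ∀ m n → fromℕ (m ℕ.* n) ≡ fromℕ m * fromℕ n
fromℕ-homo-* m n = trans (cong fromℤ (ℤP.pos-* m n)) (fromℤ-homo-* (ℤ.+ m) (ℤ.+ n))

fromℕ-mono-≤ : ∀ {m n} → m ℕ.≤ n → fromℕ m ≤ fromℕ n
fromℕ-mono-≤ {m} {n} m≤n rewrite fromℤ≡mkℚ (ℤ.+ m) | fromℤ≡mkℚ (ℤ.+ n) =
  *≤* (subst₂ ℤ._≤_ (sym (ℤP.*-identityʳ (ℤ.+ m))) (sym (ℤP.*-identityʳ (ℤ.+ n))) (ℤ.+≤+ m≤n))

[b]ℚ≡fromℕ[b] : ∀ b → [ b ]ℚ ≡ fromℕ [ b ]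
[b]ℚ≡fromℕ[b] true  = refl
[b]ℚ≡fromℕ[b] false = refl

Σℕ-cong : ∀ n {f g : Fin n → ℕ} → (∀ i → f i ≡ g i) → Σℕ n f ≡ Σℕ n g
Σℕ-cong zero    f≗g = refl
Σℕ-cong (suc n) f≗g = cong₂ ℕ._+_ (f≗g zero) (Σℕ-cong n (f≗g ∘ suc))

fromℕ-Σℕ : ∀ n (f : Fin n → ℕ) → fromℕ (Σℕ n f) ≡ Σℚ n (fromℕ ∘ f)
fromℕ-Σℕ zero    f = refl
fromℕ-Σℕ (suc n) f = trans (fromℕ-homo-+ (f zero) _) (cong (fromℕ (f zero) +_) (fromℕ-Σℕ n (f ∘ suc)))

Σℚ≡sum : ∀ n (f : Fin n → ℚ) → Σℚ n f ≡ sum f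
Σℚ≡sum zero    f = refl
Σℚ≡sum (suc n) f = cong (f zero +_) (Σℚ≡sum n (f ∘ suc))

Σℚ-cong : ∀ n {f g : Fin n → ℚ} → (∀ i → f i ≡ g i) → Σℚ n f ≡ Σℚ n g
Σℚ-cong zero    f≗g = refl
Σℚ-cong (suc n) f≗g = cong₂ _+_ (f≗g zero) (Σℚ-cong n (f≗g ∘ suc))

Σℚ-distrib-+ : ∀ n (f g : Fin n → ℚ) → Σℚ n (λ i → f i + g i) ≡ Σℚ n f + Σℚ n g
Σℚ-distrib-+ n f g = begin
  Σℚ n (λ i → f i + g i)   ≡⟨ Σℚ≡sum n _ ⟩
  ∑[ i < n ] (f i + g i)   ≡⟨ ∑-distrib-+ f g ⟩
  sum f + sum g            ≡⟨ sym (cong₂ _+_ (Σℚ≡sum n f) (Σℚ≡sum n g)) ⟩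
  Σℚ n f + Σℚ n g          ∎
  where open ≡-Reasoning

Σℚ-*ˡ : ∀ n x (f : Fin n → ℚ) → Σℚ n (λ i → x * f i) ≡ x * Σℚ n f
Σℚ-*ˡ n x f = begin
  Σℚ n (λ i → x * f i)   ≡⟨ Σℚ≡sum n _ ⟩
  ∑[ i < n ] (x * f i)   ≡⟨ sym (*-distribˡ-sum x f) ⟩
  x * sum f              ≡⟨ cong (x *_) (sym (Σℚ≡sum n f)) ⟩
  x * Σℚ n f             ∎
  where open ≡-Reasoning

Σℚ-δ : ∀ n (α : Fin n → ℚ) i → Σℚ n (λ l → α l * [ does (l ≟ i) ]ℚ) ≡ α i
Σℚ-δ (suc n) α zero = begin
  α zero * 1ℚ + Σℚ n (λ l → α (suc l) * 0ℚ)  ≡⟨ cong (α zero * 1ℚ +_) (Σℚ≡sum n _) ⟩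
  α zero * 1ℚ + ∑[ l < n ] (α (suc l) * 0ℚ)  ≡⟨ cong (α zero * 1ℚ +_) (sum-cong-≗ (ℚP.*-zeroʳ ∘ α ∘ suc)) ⟩
  α zero * 1ℚ + ∑[ _ < n ] 0ℚ                ≡⟨ cong (α zero * 1ℚ +_) (sum-replicate-zero n) ⟩
  α zero * 1ℚ + 0ℚ                           ≡⟨ solve 1 (λ a → a :* con 1ℚ :+ con 0ℚ := a) refl (α zero) ⟩
  α zero                                     ∎
  where open ≡-Reasoning
Σℚ-δ (suc n) α (suc i) = trans (cong (α zero * 0ℚ +_) (Σℚ-δ n (α ∘ suc) i))
  (solve 2 (λ a b → a :* con 0ℚ :+ b := b) refl (α zero) (α (suc i)))

fromℕ-Σℕ-* : ∀ n (a w : Fin n → ℕ) → fromℕ (Σℕ n (λ e → a e ℕ.* w e)) ≡ ∑[ e < n ] (fromℕ (a e) * fromℕ (w e))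
fromℕ-Σℕ-* n a w = begin
  fromℕ (Σℕ n (λ e → a e ℕ.* w e))          ≡⟨ fromℕ-Σℕ n _ ⟩
  Σℚ n (λ e → fromℕ (a e ℕ.* w e))          ≡⟨ Σℚ≡sum n _ ⟩
  ∑[ e < n ] fromℕ (a e ℕ.* w e)            ≡⟨ sum-cong-≗ (λ e → fromℕ-homo-* (a e) (w e)) ⟩
  ∑[ e < n ] (fromℕ (a e) * fromℕ (w e))    ∎
  where open ≡-Reasoning

module _ {m n} (c : Fin m → ℕ) (M : Fin n → Fin m → Bool) (α : Fin n → ℚ)
         (c≡∑αM : ∀ e → fromℕ (c e) ≡ Σℚ n (λ l → α l * [ M l e ]ℚ)) where

  ∑c*w≡∑α*∑M*w : ∀ (w : Fin m → ℕ) →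
    fromℕ (Σℕ m (λ e → c e ℕ.* w e)) ≡ Σℚ n (λ l → α l * fromℕ (Σℕ m (λ e → [ M l e ] ℕ.* w e)))
  ∑c*w≡∑α*∑M*w w = begin
    fromℕ (Σℕ m (λ e → c e ℕ.* w e))                       ≡⟨ fromℕ-Σℕ-* m c w ⟩
    ∑[ e < m ] (fromℕ (c e) * w̃ e)                         ≡⟨ sum-cong-≗ (λ e → cong (_* w̃ e) (trans (c≡∑αM e) (Σℚ≡sum n _))) ⟩
    ∑[ e < m ] ((∑[ l < n ] (α l * [ M l e ]ℚ)) * w̃ e)      ≡⟨ sum-cong-≗ (λ e → *-distribʳ-sum (w̃ e) (λ l → α l * [ M l e ]ℚ)) ⟩
    ∑[ e < m ] ∑[ l < n ] (α l * [ M l e ]ℚ * w̃ e)          ≡⟨ ∑-comm (λ e l → α l * [ M l e ]ℚ * w̃ e) ⟩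
    ∑[ l < n ] ∑[ e < m ] (α l * [ M l e ]ℚ * w̃ e)          ≡⟨ sum-cong-≗ (λ l → sum-cong-≗ (λ e → ℚP.*-assoc (α l) [ M l e ]ℚ (w̃ e))) ⟩
    ∑[ l < n ] ∑[ e < m ] (α l * ([ M l e ]ℚ * w̃ e))        ≡⟨ sum-cong-≗ (λ l → sym (*-distribˡ-sum (α l) (λ e → [ M l e ]ℚ * w̃ e))) ⟩
    ∑[ l < n ] (α l * ∑[ e < m ] ([ M l e ]ℚ * w̃ e))        ≡⟨ sum-cong-≗ (λ l → cong (α l *_) (sym (∑[M]w l))) ⟩
    ∑[ l < n ] (α l * fromℕ (Σℕ m (λ e → [ M l e ] ℕ.* w e)))  ≡⟨ sym (Σℚ≡sum n _) ⟩
    Σℚ n (λ l → α l * fromℕ (Σℕ m (λ e → [ M l e ] ℕ.* w e)))  ∎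
    where
    open ≡-Reasoning
    w̃ : Fin m → ℚ
    w̃ = fromℕ ∘ w
    ∑[M]w : ∀ l → fromℕ (Σℕ m (λ e → [ M l e ] ℕ.* w e)) ≡ ∑[ e < m ] ([ M l e ]ℚ * w̃ e)
    ∑[M]w l = trans (fromℕ-Σℕ-* m (λ e → [ M l e ]) w)
                    (sum-cong-≗ (λ e → cong (_* w̃ e) (sym ([b]ℚ≡fromℕ[b] (M l e)))))

½*fromℤ[r+2q] : ∀ r q → ½ * fromℤ (ℤ.+ r ℤ.+ q ℤ.* ℤ.+ 2) ≡ fromℤ q + ½ * fromℕ r
½*fromℤ[r+2q] r q = begin
  ½ * fromℤ (ℤ.+ r ℤ.+ q ℤ.* ℤ.+ 2)        ≡⟨ cong (½ *_) (fromℤ-homo-+ (ℤ.+ r) (q ℤ.* ℤ.+ 2)) ⟩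
  ½ * (fromℕ r + fromℤ (q ℤ.* ℤ.+ 2))      ≡⟨ cong (λ t → ½ * (fromℕ r + t)) (fromℤ-homo-* q (ℤ.+ 2)) ⟩
  ½ * (fromℕ r + fromℤ q * fromℕ 2)        ≡⟨ solve 2 (λ r q → con ½ :* (r :+ q :* con (fromℕ 2)) := q :+ con ½ :* r) refl (fromℕ r) (fromℤ q) ⟩
  fromℤ q + ½ * fromℕ r                    ∎
  where open ≡-Reasoning

x+x≡y⇒x≡½*y : ∀ {x y} → x + x ≡ y → x ≡ ½ * y
x+x≡y⇒x≡½*y {x} x+x≡y = trans (solve 1 (λ x → x := con ½ :* (x :+ x)) refl x) (cong (½ *_) x+x≡y)

integral-or-half-integral : ∀ x (m : ℤ) → x + x ≡ fromℤ m →
  (∃ λ z → x ≡ fromℤ z) ⊎ (∃ λ z → x ≡ fromℤ z + ½)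
integral-or-half-integral x m x+x≡m with m %ℕ 2 | n%ℕd<d m 2 | a≡a%ℕn+[a/ℕn]*n m 2
... | 0 | _ | m≡r+2q = inj₁ (m /ℕ 2 , (begin
  x                                   ≡⟨ x+x≡y⇒x≡½*y (trans x+x≡m (cong fromℤ m≡r+2q)) ⟩
  ½ * fromℤ (ℤ.+ 0 ℤ.+ m /ℕ 2 ℤ.* ℤ.+ 2)  ≡⟨ ½*fromℤ[r+2q] 0 (m /ℕ 2) ⟩
  fromℤ (m /ℕ 2) + ½ * 0ℚ              ≡⟨ solve 1 (λ q → q :+ con ½ :* con 0ℚ := q) refl (fromℤ (m /ℕ 2)) ⟩
  fromℤ (m /ℕ 2)                       ∎))
  where open ≡-Reasoning
... | 1 | _ | m≡r+2q = inj₂ (m /ℕ 2 , (begin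
  x                                   ≡⟨ x+x≡y⇒x≡½*y (trans x+x≡m (cong fromℤ m≡r+2q)) ⟩
  ½ * fromℤ (ℤ.+ 1 ℤ.+ m /ℕ 2 ℤ.* ℤ.+ 2)  ≡⟨ ½*fromℤ[r+2q] 1 (m /ℕ 2) ⟩
  fromℤ (m /ℕ 2) + ½ * 1ℚ              ≡⟨ solve 1 (λ q → q :+ con ½ :* con 1ℚ := q :+ con ½) refl (fromℤ (m /ℕ 2)) ⟩
  fromℤ (m /ℕ 2) + ½                   ∎))
  where open ≡-Reasoning
... | suc (suc _) | s≤s (s≤s ()) | _

x+y≡z⇒y≡z-x : ∀ {x y z} → x + y ≡ z → y ≡ z - x
x+y≡z⇒y≡z-x {x} {y} x+y≡z = trans (solve 2 (λ x y → y := (x :+ y) :- x) refl x y) (cong (_- x) x+y≡z)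

module _ {n} (a : Fin (3 ℕ.+ n) → ℚ) (pair : ∀ i j → i ≢ j → ∃ λ z → a i + a j ≡ fromℤ z) where

  pairwise-integral⇒half-integral : (∀ i → ∃ λ z → a i ≡ fromℤ z) ⊎ (∀ i → ∃ λ z → a i ≡ fromℤ z + ½)
  pairwise-integral⇒half-integral =
    Sum.map integral half-integral (integral-or-half-integral (a zero) (z₀₁ ℤ.+ z₀₂ ℤ.- z₁₂) a₀+a₀≡z)
    where
    open ≡-Reasoning
    p₀₁ = pair zero (suc zero) (λ ())
    p₀₂ = pair zero (suc (suc zero)) (λ ())
    p₁₂ = pair (suc zero) (suc (suc zero)) (λ ())
    z₀₁ = proj₁ p₀₁
    z₀₂ = proj₁ p₀₂
    z₁₂ = proj₁ p₁₂

    a₀+a₀≡z : a zero + a zero ≡ fromℤ (z₀₁ ℤ.+ z₀₂ ℤ.- z₁₂)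
    a₀+a₀≡z = begin
      a₀ + a₀                              ≡⟨ solve 3 (λ x y z → x :+ x := (x :+ y) :+ (x :+ z) :- (y :+ z)) refl a₀ a₁ a₂ ⟩
      (a₀ + a₁) + (a₀ + a₂) - (a₁ + a₂)    ≡⟨ cong₂ _-_ (cong₂ _+_ (proj₂ p₀₁) (proj₂ p₀₂)) (proj₂ p₁₂) ⟩
      fromℤ z₀₁ + fromℤ z₀₂ - fromℤ z₁₂    ≡⟨ sym (trans (fromℤ-homo-- (z₀₁ ℤ.+ z₀₂) z₁₂) (cong (_- fromℤ z₁₂) (fromℤ-homo-+ z₀₁ z₀₂))) ⟩
      fromℤ (z₀₁ ℤ.+ z₀₂ ℤ.- z₁₂)          ∎
      where
      a₀ = a zero
      a₁ = a (suc zero)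
      a₂ = a (suc (suc zero))

    integral : (∃ λ z → a zero ≡ fromℤ z) → ∀ i → ∃ λ z → a i ≡ fromℤ z
    integral (z₀ , a₀≡z₀) zero = z₀ , a₀≡z₀
    integral (z₀ , a₀≡z₀) (suc i) with pair zero (suc i) (λ ())
    ... | z , a₀+aᵢ≡z = z ℤ.- z₀ , (begin
      a (suc i)               ≡⟨ x+y≡z⇒y≡z-x a₀+aᵢ≡z ⟩
      fromℤ z - a zero        ≡⟨ cong (λ t → fromℤ z - t) a₀≡z₀ ⟩
      fromℤ z - fromℤ z₀      ≡⟨ sym (fromℤ-homo-- z z₀) ⟩
      fromℤ (z ℤ.- z₀)        ∎)

    half-integral : (∃ λ z → a zero ≡ fromℤ z + ½) → ∀ i → ∃ λ z → a i ≡ fromℤ z + ½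
    half-integral (z₀ , a₀≡z₀+½) zero = z₀ , a₀≡z₀+½
    half-integral (z₀ , a₀≡z₀+½) (suc i) with pair zero (suc i) (λ ())
    ... | z , a₀+aᵢ≡z = z ℤ.- z₀ ℤ.- ℤ.+ 1 , (begin
      a (suc i)                            ≡⟨ x+y≡z⇒y≡z-x a₀+aᵢ≡z ⟩
      fromℤ z - a zero                     ≡⟨ cong (λ t → fromℤ z - t) a₀≡z₀+½ ⟩
      fromℤ z - (fromℤ z₀ + ½)             ≡⟨ solve 2 (λ z z₀ → z :- (z₀ :+ con ½) := (z :- z₀ :- con 1ℚ) :+ con ½) refl (fromℤ z) (fromℤ z₀) ⟩
      (fromℤ z - fromℤ z₀ - 1ℚ) + ½        ≡⟨ cong (_+ ½) (sym (trans (fromℤ-homo-- (z ℤ.- z₀) (ℤ.+ 1)) (cong (_- 1ℚ) (fromℤ-homo-- z z₀)))) ⟩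
      fromℤ (z ℤ.- z₀ ℤ.- ℤ.+ 1) + ½       ∎)

p≤p+q⇒0≤q : ∀ {p q} → p ≤ p + q → 0ℚ ≤ q
p≤p+q⇒0≤q {p} {q} p≤p+q = subst₂ _≤_ (ℚP.+-inverseˡ p) (solve 2 (λ p q → (:- p) :+ (p :+ q) := q) refl p q)
  (ℚP.+-monoʳ-≤ (- p) p≤p+q)

0≤4*q⇒0≤q : ∀ {q} → 0ℚ ≤ fromℕ 4 * q → 0ℚ ≤ q
0≤4*q⇒0≤q {q} 0≤4q = ℚP.*-cancelˡ-≤-pos (fromℕ 4) (subst₂ _≤_ (sym (ℚP.*-zeroʳ (fromℕ 4))) refl 0≤4q)

data ExactlyOne : Bool → Bool → Bool → Set where
  first  : ExactlyOne true false false
  second : ExactlyOne false true false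
  third  : ExactlyOne false false true

-- The hypothesis is the normal form of the degree of a vertex of P incident with edges a, b, c.
exactlyOne : ∀ {a b c} → Σℕ 3 (λ i → [ lookup (a ∷ b ∷ c ∷ []) i ]) ≡ 1 → ExactlyOne a b c
exactlyOne {true}  {false} {false} _ = first
exactlyOne {false} {true}  {false} _ = second
exactlyOne {false} {false} {true}  _ = third
exactlyOne {true}  {true}  {_}     ()
exactlyOne {true}  {false} {true}  ()
exactlyOne {false} {true}  {true}  ()
exactlyOne {false} {false} {false} ()

[b]*[t]≡[t∧b] : ∀ b t → [ b ] ℕ.* [ t ] ≡ [ t ∧ b ]
[b]*[t]≡[t∧b] b true  = ℕP.*-identityʳ [ b ]
[b]*[t]≡[t∧b] b false = ℕP.*-zeroʳ [ b ]

matchingEdges : Fin 6 → List E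
matchingEdges zero                               = # 0 ∷ # 2 ∷ # 9 ∷ # 10 ∷ # 11 ∷ []
matchingEdges (suc zero)                         = # 0 ∷ # 3 ∷ # 7 ∷ # 13 ∷ # 14 ∷ []
matchingEdges (suc (suc zero))                   = # 1 ∷ # 3 ∷ # 5 ∷ # 11 ∷ # 12 ∷ []
matchingEdges (suc (suc (suc zero)))             = # 1 ∷ # 4 ∷ # 8 ∷ # 10 ∷ # 14 ∷ []
matchingEdges (suc (suc (suc (suc zero))))       = # 2 ∷ # 4 ∷ # 6 ∷ # 12 ∷ # 13 ∷ []
matchingEdges (suc (suc (suc (suc (suc zero))))) = # 5 ∷ # 6 ∷ # 7 ∷ # 8 ∷ # 9 ∷ []

matching : Fin 6 → E → Bool
matching k e = does (List.any? (e ≟_) (matchingEdges k))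

-- The i-th argument records which edge at vertex i is chosen (vertex 0 meets edges 0, 4, 5, and so
-- on); unification rules out every inconsistent combination, leaving the six perfect matchings.
classify : ∀ {b₀ b₁ b₂ b₃ b₄ b₅ b₆ b₇ b₈ b₉ b₁₀ b₁₁ b₁₂ b₁₃ b₁₄} →
  ExactlyOne b₀ b₄ b₅ → ExactlyOne b₀ b₁ b₆ → ExactlyOne b₁ b₂ b₇ → ExactlyOne b₂ b₃ b₈ →
  ExactlyOne b₃ b₄ b₉ → ExactlyOne b₅ b₁₀ b₁₃ → ExactlyOne b₆ b₁₁ b₁₄ → ExactlyOne b₇ b₁₀ b₁₂ →
  ExactlyOne b₈ b₁₁ b₁₃ → ExactlyOne b₉ b₁₂ b₁₄ →
  ∃ λ k → b₀ ∷ b₁ ∷ b₂ ∷ b₃ ∷ b₄ ∷ b₅ ∷ b₆ ∷ b₇ ∷ b₈ ∷ b₉ ∷ b₁₀ ∷ b₁₁ ∷ b₁₂ ∷ b₁₃ ∷ b₁₄ ∷ [] ≡ tabulate (matching k)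
classify first  first  second first  third  second second second second first  = # 0 , refl
classify first  first  third  second first  third  third  first  third  third  = # 1 , refl
classify third  second first  second first  first  second third  second second = # 2 , refl
classify second second first  third  second second third  second first  third  = # 3 , refl
classify second third  second first  second third  first  third  third  second = # 4 , refl
classify third  third  third  third  third  first  first  first  first  first  = # 5 , refl

classification : ∀ m → IsPerfectMatching m → ∃ λ k → ∀ e → m e ≡ matching k e
classification m isPM
  with classify (exactlyOne (deg (# 0))) (exactlyOne (deg (# 1))) (exactlyOne (deg (# 2)))
                (exactlyOne (deg (# 3))) (exactlyOne (deg (# 4))) (exactlyOne (deg (# 5)))
                (exactlyOne (deg (# 6))) (exactlyOne (deg (# 7))) (exactlyOne (deg (# 8)))
                (exactlyOne (deg (# 9)))
  where
  deg : ∀ x → Σℕ 15 (λ e → [ incident x e ∧ m e ]) ≡ 1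
  deg x = trans (Σℕ-cong 15 (λ e → sym ([b]*[t]≡[t∧b] (m e) (incident x e)))) (isPM x)
... | k , m≡Mₖ = k , λ e → trans (sym (lookup∘tabulate m e))
                                 (trans (cong (λ v → lookup v e) m≡Mₖ) (lookup∘tabulate (matching k) e))

oddSetVertices : Fin 6 → List V
oddSetVertices zero                               = # 1 ∷ # 2 ∷ # 6 ∷ # 7 ∷ # 9 ∷ []
oddSetVertices (suc zero)                         = # 1 ∷ # 2 ∷ # 3 ∷ # 6 ∷ # 8 ∷ []
oddSetVertices (suc (suc zero))                   = # 0 ∷ # 1 ∷ # 4 ∷ # 6 ∷ # 9 ∷ []
oddSetVertices (suc (suc (suc zero)))             = # 0 ∷ # 1 ∷ # 5 ∷ # 6 ∷ # 8 ∷ []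
oddSetVertices (suc (suc (suc (suc zero))))       = # 0 ∷ # 1 ∷ # 2 ∷ # 5 ∷ # 7 ∷ []
oddSetVertices (suc (suc (suc (suc (suc zero))))) = # 0 ∷ # 1 ∷ # 2 ∷ # 3 ∷ # 4 ∷ []

oddSet : Fin 6 → V → Bool
oddSet k x = does (List.any? (x ≟_) (oddSetVertices k))

oddSet-odd : ∀ k → Odd (size (oddSet k)) × Odd (10 ℕ.∸ size (oddSet k))
oddSet-odd = from-yes (all? λ k → (size (oddSet k) ℕ.% 2 ℕ.≟ 1) ×-dec ((10 ℕ.∸ size (oddSet k)) ℕ.% 2 ℕ.≟ 1))

cut-meets-matching : ∀ k l →
  Σℕ 15 (λ e → [ matching l e ] ℕ.* [ oddSet k (end₁ e) xor oddSet k (end₂ e) ]) ≡ 1 ℕ.+ 4 ℕ.* [ does (l ≟ k) ]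
cut-meets-matching = from-yes (all? λ k → all? λ l →
  Σℕ 15 (λ e → [ matching l e ] ℕ.* [ oddSet k (end₁ e) xor oddSet k (end₂ e) ]) ℕ.≟ 1 ℕ.+ 4 ℕ.* [ does (l ≟ k) ])

matchings-share-private-edge : ∀ i j → i ≢ j →
  ∃ λ e → ∀ l → [ matching l e ] ≡ [ does (l ≟ i) ] ℕ.+ [ does (l ≟ j) ]
matchings-share-private-edge = from-yes (all? λ i → all? λ j → ¬? (i ≟ j) →-dec any? λ e → all? λ l →
  [ matching l e ] ℕ.≟ [ does (l ≟ i) ] ℕ.+ [ does (l ≟ j) ])

does-≟-injective : ∀ {n} {f : Fin n → Fin n} → (∀ {i j} → f i ≡ f j → i ≡ j) →
  ∀ i j → does (f i ≟ f j) ≡ does (i ≟ j)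
does-≟-injective {f = f} f-inj i j with i ≟ j | f i ≟ f j
... | yes refl | yes _       = refl
... | yes refl | no fi≢fi    = ⊥-elim (fi≢fi refl)
... | no i≢j   | yes fi≡fj   = ⊥-elim (i≢j (f-inj fi≡fj))
... | no _     | no _        = refl

fromℕ[1+4*[b]] : ∀ b → fromℕ (1 ℕ.+ 4 ℕ.* [ b ]) ≡ 1ℚ + fromℕ 4 * [ b ]ℚ
fromℕ[1+4*[b]] true  = refl
fromℕ[1+4*[b]] false = refl

module _ (r : ℕ) (c : E → ℕ) (rg : IsRGraph r c)
         (M : Fin 6 → E → Bool) (isPM : ∀ i → IsPerfectMatching (M i))
         (M-inj : ∀ i j → (∀ e → M i e ≡ M j e) → i ≡ j)
         (α : Fin 6 → ℚ) (c≡∑αM : ∀ e → fromℕ (c e) ≡ Σℚ 6 (λ i → α i * [ M i e ]ℚ)) where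

  private
    open ≡-Reasoning

    index : Fin 6 → Fin 6
    index i = proj₁ (classification (M i) (isPM i))

    M≗matching : ∀ i e → M i e ≡ matching (index i) e
    M≗matching i = proj₂ (classification (M i) (isPM i))

    index-injective : ∀ {i j} → index i ≡ index j → i ≡ j
    index-injective {i} {j} eq = M-inj i j λ e →
      trans (M≗matching i e) (trans (cong (λ k → matching k e) eq) (sym (M≗matching j e)))

    does-index≟index : ∀ l i → does (index l ≟ index i) ≡ does (l ≟ i)
    does-index≟index = does-≟-injective {f = index} index-injective

    r≡∑α : fromℕ r ≡ Σℚ 6 α
    r≡∑α = begin
      fromℕ r                                                              ≡⟨ cong fromℕ (sym (proj₁ rg (# 0))) ⟩
      fromℕ (Σℕ 15 (λ e → c e ℕ.* [ incident (# 0) e ]))                  ≡⟨ ∑c*w≡∑α*∑M*w c M α c≡∑αM (λ e → [ incident (# 0) e ]) ⟩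
      Σℚ 6 (λ l → α l * fromℕ (Σℕ 15 (λ e → [ M l e ] ℕ.* [ incident (# 0) e ])))
                                                                           ≡⟨ Σℚ-cong 6 (λ l → cong (λ t → α l * fromℕ t) (isPM l (# 0))) ⟩
      Σℚ 6 (λ l → α l * 1ℚ)                                                ≡⟨ Σℚ-cong 6 (ℚP.*-identityʳ ∘ α) ⟩
      Σℚ 6 α                                                               ∎

    cut≡∑α+4α : ∀ i → fromℕ (cutSize c (oddSet (index i))) ≡ Σℚ 6 α + fromℕ 4 * α i
    cut≡∑α+4α i = begin
      fromℕ (cutSize c S)                                        ≡⟨ ∑c*w≡∑α*∑M*w c M α c≡∑αM w ⟩
      Σℚ 6 (λ l → α l * fromℕ (Σℕ 15 (λ e → [ M l e ] ℕ.* w e)))  ≡⟨ Σℚ-cong 6 (λ l → cong (α l *_) (weight l)) ⟩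
      Σℚ 6 (λ l → α l * (1ℚ + fromℕ 4 * δ l))                    ≡⟨ Σℚ-cong 6 (λ l → solve 3 (λ a f d → a :* (con 1ℚ :+ f :* d) := a :+ f :* (a :* d)) refl (α l) (fromℕ 4) (δ l)) ⟩
      Σℚ 6 (λ l → α l + fromℕ 4 * (α l * δ l))                   ≡⟨ Σℚ-distrib-+ 6 α (λ l → fromℕ 4 * (α l * δ l)) ⟩
      Σℚ 6 α + Σℚ 6 (λ l → fromℕ 4 * (α l * δ l))                ≡⟨ cong (Σℚ 6 α +_) (Σℚ-*ˡ 6 (fromℕ 4) (λ l → α l * δ l)) ⟩
      Σℚ 6 α + fromℕ 4 * Σℚ 6 (λ l → α l * δ l)                  ≡⟨ cong (λ t → Σℚ 6 α + fromℕ 4 * t) (Σℚ-δ 6 α i) ⟩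
      Σℚ 6 α + fromℕ 4 * α i                                     ∎
      where
      S = oddSet (index i)
      w : E → ℕ
      w e = [ S (end₁ e) xor S (end₂ e) ]
      δ : Fin 6 → ℚ
      δ l = [ does (l ≟ i) ]ℚ
      weight : ∀ l → fromℕ (Σℕ 15 (λ e → [ M l e ] ℕ.* w e)) ≡ 1ℚ + fromℕ 4 * δ l
      weight l = begin
        fromℕ (Σℕ 15 (λ e → [ M l e ] ℕ.* w e))                   ≡⟨ cong fromℕ (Σℕ-cong 15 (λ e → cong (λ b → [ b ] ℕ.* w e) (M≗matching l e))) ⟩
        fromℕ (Σℕ 15 (λ e → [ matching (index l) e ] ℕ.* w e))    ≡⟨ cong fromℕ (cut-meets-matching (index i) (index l)) ⟩
        fromℕ (1 ℕ.+ 4 ℕ.* [ does (index l ≟ index i) ])          ≡⟨ cong (λ b → fromℕ (1 ℕ.+ 4 ℕ.* [ b ])) (does-index≟index l i) ⟩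
        fromℕ (1 ℕ.+ 4 ℕ.* [ does (l ≟ i) ])                      ≡⟨ fromℕ[1+4*[b]] (does (l ≟ i)) ⟩
        1ℚ + fromℕ 4 * δ l                                        ∎

  α-nonneg : ∀ i → 0ℚ ≤ α i
  α-nonneg i = 0≤4*q⇒0≤q (p≤p+q⇒0≤q (subst₂ _≤_ r≡∑α (cut≡∑α+4α i) (fromℕ-mono-≤ r≤cut)))
    where
    r≤cut : r ℕ.≤ cutSize c (oddSet (index i))
    r≤cut = let (odd , odd′) = oddSet-odd (index i) in proj₂ rg (oddSet (index i)) odd odd′

  α-pairwise-integral : ∀ i j → i ≢ j → ∃ λ z → α i + α j ≡ fromℤ z
  α-pairwise-integral i j i≢j =
    from-private-edge (matchings-share-private-edge (index i) (index j) (λ eq → i≢j (index-injective {i} {j} eq)))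
    where
    from-private-edge : (∃ λ e → ∀ l → [ matching l e ] ≡ [ does (l ≟ index i) ] ℕ.+ [ does (l ≟ index j) ]) →
                        ∃ λ z → α i + α j ≡ fromℤ z
    from-private-edge (e , private-edge) = ℤ.+ c e , sym (begin
      fromℕ (c e)                                             ≡⟨ c≡∑αM e ⟩
      Σℚ 6 (λ l → α l * [ M l e ]ℚ)                           ≡⟨ Σℚ-cong 6 (λ l → cong (α l *_) (M-at-e l)) ⟩
      Σℚ 6 (λ l → α l * ([ does (l ≟ i) ]ℚ + [ does (l ≟ j) ]ℚ))
                                                              ≡⟨ Σℚ-cong 6 (λ l → ℚP.*-distribˡ-+ (α l) [ does (l ≟ i) ]ℚ [ does (l ≟ j) ]ℚ) ⟩
      Σℚ 6 (λ l → α l * [ does (l ≟ i) ]ℚ + α l * [ does (l ≟ j) ]ℚ)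
                                                              ≡⟨ Σℚ-distrib-+ 6 (λ l → α l * [ does (l ≟ i) ]ℚ) (λ l → α l * [ does (l ≟ j) ]ℚ) ⟩
      Σℚ 6 (λ l → α l * [ does (l ≟ i) ]ℚ) + Σℚ 6 (λ l → α l * [ does (l ≟ j) ]ℚ)
                                                              ≡⟨ cong₂ _+_ (Σℚ-δ 6 α i) (Σℚ-δ 6 α j) ⟩
      α i + α j                                               ∎)
      where
      M-at-e : ∀ l → [ M l e ]ℚ ≡ [ does (l ≟ i) ]ℚ + [ does (l ≟ j) ]ℚ
      M-at-e l = begin
        [ M l e ]ℚ                                                         ≡⟨ [b]ℚ≡fromℕ[b] (M l e) ⟩
        fromℕ [ M l e ]                                                    ≡⟨ cong (fromℕ ∘ [_]) (M≗matching l e) ⟩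
        fromℕ [ matching (index l) e ]                                     ≡⟨ cong fromℕ (private-edge (index l)) ⟩
        fromℕ ([ does (index l ≟ index i) ] ℕ.+ [ does (index l ≟ index j) ])
                                                                           ≡⟨ cong₂ (λ a b → fromℕ ([ a ] ℕ.+ [ b ])) (does-index≟index l i) (does-index≟index l j) ⟩
        fromℕ ([ does (l ≟ i) ] ℕ.+ [ does (l ≟ j) ])                      ≡⟨ fromℕ-homo-+ [ does (l ≟ i) ] [ does (l ≟ j) ] ⟩
        fromℕ [ does (l ≟ i) ] + fromℕ [ does (l ≟ j) ]                    ≡⟨ sym (cong₂ _+_ ([b]ℚ≡fromℕ[b] (does (l ≟ i))) ([b]ℚ≡fromℕ[b] (does (l ≟ j)))) ⟩
        [ does (l ≟ i) ]ℚ + [ does (l ≟ j) ]ℚ                              ∎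

lemma3 : (r : ℕ) (c : E → ℕ) → (∀ e → 1 ℕ.≤ c e) → IsRGraph r c →
    (M : Fin 6 → E → Bool) → (∀ i → IsPerfectMatching (M i)) →
    (∀ i j → (∀ e → M i e ≡ M j e) → i ≡ j) →
    (α : Fin 6 → ℚ) →
    (∀ e → ℤ.+ c e / 1 ≡ Σℚ 6 (λ i → α i * [ M i e ]ℚ)) →
    (∀ i → 0ℚ ≤ α i) ×
    ((∀ i → ∃ λ (z : ℤ) → α i ≡ z / 1) ⊎ (∀ i → ∃ λ (z : ℤ) → α i ≡ z / 1 + ½))
lemma3 r c _ rg M isPM M-inj α c≡∑αM =
  α-nonneg r c rg M isPM M-inj α c≡∑αM ,
  pairwise-integral⇒half-integral α (α-pairwise-integral r c rg M isPM M-inj α c≡∑αM)
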